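{- For every $n\ge1$, the noncommutative polynomials $\mathbf{N}_{G_{\mathbf{K}}}$, where $\mathbf{K}$ runs over the set compositions of $\{1,\dots,n\}$ with an even number of parts, are linearly independent.
   Context: A set composition of $\{1,\dots,n\}$ is an ordered list $\mathbf{K}=(K_1,\dots,K_p)$ of pairwise disjoint nonempty subsets whose union is $\{1,\dots,n\}$. For $\mathbf{K}=(K_1,\dots,K_{2\ell})$, the labelled bipartite graph $G_{\mathbf{K}}$ has vertex set $\{1,\dots,n\}=V_1\sqcup V_2$ with $V_1=K_1\sqcup K_3\sqcup\dots\sqcup K_{2\ell-1}$, $V_2=K_2\sqcup K_4\sqcup\dots\sqcup K_{2\ell}$, and edge sets $E_{1,2}=(K_1\times K_2)\sqcup(K_3\times K_4)\sqcup\dots\sqcup(K_{2\ell-1}\times K_{2\ell})$ and $E_{2,1}=(K_2\times K_3)\sqcup(K_4\times K_5)\sqcup\dots\sqcup(K_{2\ell-2}\times K_{2\ell-1})$ (pairs of $E_{2,1}$ are listed as $(v_2,v_1)$ with $v_2\in V_2$, $v_1\in V_1$). A map $r:\{1,\dots,n\}\to\mathbb{Z}_{>0}$ satisfies the order condition if $r(v_1)\le r(v_2)$ for each edge of $E_{1,2}$ joining $v_1\in V_1$ to $v_2\in V_2$, and $r(v_2)<r(v_1)$ for each edge of $E_{2,1}$ joining $v_2\in V_2$ to $v_1\in V_1$. With noncommuting variables $b_1,b_2,\dots,d_1,d_2,\dots$, $\mathbf{N}_{G}$ is the stable noncommutative polynomial whose $m$-th component is $\sum_r\gamma_1\gamma_2\cdots\gamma_n$,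 summed over $r:\{1,\dots,n\}\to\{1,\dots,m\}$ with the order condition, where $\gamma_i=b_{r(i)}$ if $i\in V_1$ and $\gamma_i=d_{r(i)}$ if $i\in V_2$. -}

module Defs where

open import Data.Nat using (ℕ; zero; suc; _≤_; _<_; _*_; _≡ᵇ_; _%_)
open import Data.Nat.Properties using (_≤?_; _<?_) renaming (_≟_ to _≟ℕ_)
open import Data.Fin using (Fin; toℕ) renaming (zero to fz; suc to fs)
open import Data.Fin.Properties using (all?) renaming (_≟_ to _≟F_)
open import Data.Bool using (Bool; true; false; if_then_else_; _∧_)
open import Data.Bool.Properties using () renaming (_≟_ to _≟B_)
open import Data.Product using (_×_; _,_; ∃-syntax)
open import Data.Product.Properties using (≡-dec)
open import Data.Integer using (ℤ; _+_; 0ℤ; 1ℤ)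
open import Relation.Binary.PropositionalEquality using (_≡_)
open import Relation.Nullary using (Dec; yes; no)
open import Relation.Nullary.Decidable using (⌊_⌋; _→-dec_)

-- A set composition K = (K_1, ..., K_p) of {1,...,n} (vertices encoded as Fin n),
-- given by its block map: vertex i lies in block K_{blk i + 1}.
record SetComp (n : ℕ) : Set where
  field
    parts     : ℕ
    blk       : Fin n → ℕ
    blk<parts : ∀ i → blk i < parts
    blk-surj  : ∀ j → j < parts → ∃[ i ] blk i ≡ j
open SetComp public

EvenParts : ∀ {n} → SetComp n → Set
EvenParts K = ∃[ ℓ ] parts K ≡ 2 * ℓ

-- i ∈ V_1 iff i lies in K_1, K_3, ... iff blk i is even (0-based)
inV₁ : ∀ {n} → SetComp n → Fin n → Bool
inV₁ K i = (blk K i % 2) ≡ᵇ 0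

-- constraint on an edge from block b to block b+1:
-- b even (0-based): edge of E_{1,2}, weak inequality;  b odd: edge of E_{2,1}, strict.
EdgeOK : Bool → ℕ → ℕ → Set
EdgeOK true  x y = x ≤ y
EdgeOK false x y = x < y

EdgeOK? : ∀ c x y → Dec (EdgeOK c x y)
EdgeOK? true  x y = x ≤? y
EdgeOK? false x y = x <? y

-- order condition for r : {1..n} → {1..m} (values in Fin m, i.e. r - 1)
-- edges of G_K join exactly the vertices of consecutive blocks K_j, K_{j+1}
OrderCond : ∀ {n m} → SetComp n → (Fin n → Fin m) → Set
OrderCond K r = ∀ i j → blk K j ≡ suc (blk K i) →
  EdgeOK (inV₁ K i) (toℕ (r i)) (toℕ (r j))

OrderCond? : ∀ {n m} (K : SetComp n) (r : Fin n → Fin m) → Dec (OrderCond K r)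
OrderCond? K r = all? λ i → all? λ j →
  (blk K j ≟ℕ suc (blk K i)) →-dec EdgeOK? (inV₁ K i) (toℕ (r i)) (toℕ (r j))

-- Letters: (true , k) is b_{k+1},  (false , k) is d_{k+1}
Letter : ℕ → Set
Letter m = Bool × Fin m

Word : ℕ → ℕ → Set
Word n m = Fin n → Letter m

wordOf : ∀ {n m} → SetComp n → (Fin n → Fin m) → Word n m
wordOf K r i = (inV₁ K i , r i)

_≟W_ : ∀ {n m} (u v : Word n m) → Dec (∀ i → u i ≡ v i)
u ≟W v = all? λ i → ≡-dec _≟B_ _≟F_ (u i) (v i)

sumFin : ∀ m → (Fin m → ℤ) → ℤ
sumFin zero    f = 0ℤ
sumFin (suc m) f = f fz + sumFin m (λ k → f (fs k))

sumMaps : ∀ n m → ((Fin n → Fin m) → ℤ) → ℤ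
sumMaps zero    m F = F (λ ())
sumMaps (suc n) m F = sumFin m λ a → sumMaps n m λ g →
  F (λ { fz → a ; (fs i) → g i })

-- Coefficient of the word w in the m-th component of N_{G_K}:
-- Σ_r γ_1⋯γ_n, summed over r : {1..n} → {1..m} with the order condition.
-- (All monomials have degree n, so words of other lengths have coefficient 0.)
coeffN : ∀ {n} → SetComp n → (m : ℕ) → Word n m → ℤ
coeffN {n} K m w = sumMaps n m λ r →
  if ⌊ OrderCond? K r ⌋ ∧ ⌊ wordOf K r ≟W w ⌋ then 1ℤ else 0ℤ

combCoeff : ∀ {n} k → (Fin k → SetComp n) → (Fin k → ℤ) → (m : ℕ) → Word n m → ℤ
combCoeff k K c m w = sumFin k λ a → c a Data.Integer.* coeffN (K a) m w

-- Each set composition K is detected by its canonical word: the letter at position i is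
-- b or d according to the side of i, indexed by the block of i. The only r producing this
-- word is the block map of K, which satisfies the order condition of G_K, so the word has
-- coefficient 1 in N_{G_K}. If the block map of K also satisfies the order condition of
-- G_{K'} with the same sides, then K' = K: consecutive blocks lie on opposite sides, so a
-- parity argument lets neither block map exceed the other. Hence the coefficients on the
-- canonical words form an identity matrix.
module Submission where

open import Defs
open import Data.Nat using (ℕ; _≥_; zero; suc; _≤_; _<_; _+_; _%_; _≡ᵇ_; s≤s)
open import Data.Nat.Properties
  using ( ≤-refl; ≤-reflexive; ≤-trans; ≤-antisym; _≤?_; <⇒≤; <⇒≱; ≮⇒≥; ≤∧≢⇒<; ≰⇒>
        ; n≤1+n; +-comm; m≤n⇒∃[o]m+o≡n)
open import Data.Fin using (Fin; toℕ; fromℕ<) renaming (zero to fz; suc to fs)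
open import Data.Fin.Properties using (toℕ-fromℕ<)
open import Data.Integer using (ℤ; 0ℤ; 1ℤ; _*_)
import Data.Integer as ℤ
open import Data.Integer.Properties using (+-identityˡ; +-identityʳ; *-identityʳ; *-zeroʳ)
open import Data.Bool using (Bool; true; false; not; _∧_; if_then_else_)
open import Data.Bool.Properties using (not-¬)
open import Data.Product using (_×_; _,_; proj₁; proj₂; ∃-syntax)
open import Data.Empty using (⊥-elim)
open import Function using (_∘_)
open import Relation.Nullary using (¬_; yes; no; contradiction)
open import Relation.Nullary.Decidable using (⌊_⌋)
open import Relation.Binary.PropositionalEquality
  using (_≡_; _≢_; _≗_; refl; sym; trans; cong; cong₂; subst; subst₂)
open Relation.Binary.PropositionalEquality.≡-Reasoning

isEven : ℕ → Bool
isEven x = x % 2 ≡ᵇ 0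

isEven-suc : ∀ x → isEven (suc x) ≡ not (isEven x)
isEven-suc zero          = refl
isEven-suc (suc zero)    = refl
isEven-suc (suc (suc x)) = isEven-suc x

sameParity⇒≢suc : ∀ {x y} → isEven x ≡ isEven y → x ≢ suc y
sameParity⇒≢suc {y = y} p refl = not-¬ refl (trans (sym p) (isEven-suc y))

DownClosed : ∀ {n} → (Fin n → ℕ) → Set
DownClosed f = ∀ i y → y < f i → ∃[ u ] f u ≡ y

≤-by-parity : ∀ {n} (f g : Fin n → ℕ) →
  (∀ i → isEven (f i) ≡ isEven (g i)) → DownClosed f →
  (∀ u i → f u < f i → g u ≤ g i) → ∀ i → f i ≤ g i
≤-by-parity {n} f g parity down mono i = bounded (suc (g i)) i ≤-refl
  where
  -- If f i > g i, parity gives f i > 1 + g i; the point u with f u = 1 + g i then has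
  -- g u < g i, and the induction hypothesis f u ≤ g u is absurd.
  bounded : ∀ N i → g i < N → f i ≤ g i
  bounded (suc N) i (s≤s gi≤N) with f i ≤? g i
  ... | yes fi≤gi = fi≤gi
  ... | no fi≰gi = ⊥-elim (<⇒≱ gu<gi (≤-trans (n≤1+n (g i)) 1+gi≤gu))
    where
    1+gi<fi : suc (g i) < f i
    1+gi<fi = ≤∧≢⇒< (≰⇒> fi≰gi) (λ e → sameParity⇒≢suc (parity i) (sym e))
    u : Fin n
    u = proj₁ (down i (suc (g i)) 1+gi<fi)
    fu≡1+gi : f u ≡ suc (g i)
    fu≡1+gi = proj₂ (down i (suc (g i)) 1+gi<fi)
    gu<gi : g u < g i
    gu<gi = ≤∧≢⇒< (mono u i (subst (_< f i) (sym fu≡1+gi) 1+gi<fi))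
      (λ e → sameParity⇒≢suc (trans (parity u) (cong isEven e)) fu≡1+gi)
    1+gi≤gu : suc (g i) ≤ g u
    1+gi≤gu = subst (_≤ g u) fu≡1+gi (bounded N u (≤-trans gu<gi gi≤N))

blk-downClosed : ∀ {n} (K : SetComp n) → DownClosed (blk K)
blk-downClosed K i y y<blk = blk-surj K y (≤-trans y<blk (<⇒≤ (blk<parts K i)))

edge⇒≤ : ∀ c {x y} → EdgeOK c x y → x ≤ y
edge⇒≤ true  x≤y = x≤y
edge⇒≤ false x<y = <⇒≤ x<y

<⇒edge : ∀ c {x y} → x < y → EdgeOK c x y
<⇒edge true  x<y = <⇒≤ x<y
<⇒edge false x<y = x<y

orderCond-monotone : ∀ {n m} (K : SetComp n) {r : Fin n → Fin m} → OrderCond K r →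
  ∀ {u i} → blk K u < blk K i → toℕ (r u) ≤ toℕ (r i)
orderCond-monotone K {r} oc {u} {i} u<i =
  let d , eq = m≤n⇒∃[o]m+o≡n u<i in across d (trans (sym eq) (+-comm (suc (blk K u)) d))
  where
  across : ∀ d {i} → blk K i ≡ d + suc (blk K u) → toℕ (r u) ≤ toℕ (r i)
  across zero    eq = edge⇒≤ _ (oc u _ eq)
  across (suc d) {i} eq =
    let v , blk-v = blk-downClosed K i (d + suc (blk K u)) (≤-reflexive (sym eq))
    in ≤-trans (across d blk-v) (edge⇒≤ _ (oc v i (trans eq (cong suc (sym blk-v)))))

orderCond-of-blk : ∀ {n m} (K : SetComp n) {r : Fin n → Fin m} →
  (∀ i → toℕ (r i) ≡ blk K i) → OrderCond K r
orderCond-of-blk K {r} r≡blk i j blk-j =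
  <⇒edge _ (subst₂ _<_ (sym (r≡blk i)) (sym (r≡blk j)) (≤-reflexive (sym blk-j)))

-- inV₁ K i is definitionally isEven (blk K i).
blk-unique : ∀ {n m} (K K' : SetComp n) {r : Fin n → Fin m} →
  (∀ i → inV₁ K' i ≡ inV₁ K i) → OrderCond K' r → (∀ i → toℕ (r i) ≡ blk K i) →
  ∀ i → blk K' i ≡ blk K i
blk-unique K K' {r} sameSide oc r≡blk i =
  ≤-antisym
    (≤-by-parity (blk K') (blk K) sameSide (blk-downClosed K') K'<⇒K≤ i)
    (≤-by-parity (blk K) (blk K') (λ j → sym (sameSide j)) (blk-downClosed K)
       (λ u j u<j → ≮⇒≥ (λ j<u → <⇒≱ u<j (K'<⇒K≤ j u j<u))) i)
  where
  K'<⇒K≤ : ∀ u j → blk K' u < blk K' j → blk K u ≤ blk K j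
  K'<⇒K≤ u j u<j = subst₂ _≤_ (r≡blk u) (r≡blk j) (orderCond-monotone K' oc u<j)

sumFin-zero : ∀ m (f : Fin m → ℤ) → (∀ a → f a ≡ 0ℤ) → sumFin m f ≡ 0ℤ
sumFin-zero zero    f f≡0 = refl
sumFin-zero (suc m) f f≡0 = cong₂ ℤ._+_ (f≡0 fz) (sumFin-zero m (f ∘ fs) (f≡0 ∘ fs))

sumFin-concentrated : ∀ m (f : Fin m → ℤ) a₀ →
  (∀ a → a ≢ a₀ → f a ≡ 0ℤ) → sumFin m f ≡ f a₀
sumFin-concentrated (suc m) f fz f≡0 = begin
  f fz ℤ.+ sumFin m (f ∘ fs) ≡⟨ cong (λ z → f fz ℤ.+ z) (sumFin-zero m _ (λ a → f≡0 (fs a) λ ())) ⟩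
  f fz ℤ.+ 0ℤ                ≡⟨ +-identityʳ (f fz) ⟩
  f fz                       ∎
sumFin-concentrated (suc m) f (fs a₀) f≡0 = begin
  f fz ℤ.+ sumFin m (f ∘ fs) ≡⟨ cong (λ z → z ℤ.+ sumFin m (f ∘ fs)) (f≡0 fz λ ()) ⟩
  0ℤ ℤ.+ sumFin m (f ∘ fs)   ≡⟨ +-identityˡ _ ⟩
  sumFin m (f ∘ fs)          ≡⟨ sumFin-concentrated m _ a₀ f∘fs≡0 ⟩
  f (fs a₀)                  ∎
  where
  f∘fs≡0 : ∀ a → a ≢ a₀ → f (fs a) ≡ 0ℤ
  f∘fs≡0 a a≢a₀ = f≡0 (fs a) (λ { refl → a≢a₀ refl })

sumMaps-zero : ∀ n m (F : (Fin n → Fin m) → ℤ) → (∀ r → F r ≡ 0ℤ) → sumMaps n m F ≡ 0ℤ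
sumMaps-zero zero    m F F≡0 = F≡0 _
sumMaps-zero (suc n) m F F≡0 = sumFin-zero m _ (λ a → sumMaps-zero n m _ (λ g → F≡0 _))

sumMaps-concentrated : ∀ n m (F : (Fin n → Fin m) → ℤ) r₀ v →
  (∀ r → r ≗ r₀ → F r ≡ v) → (∀ r → ¬ r ≗ r₀ → F r ≡ 0ℤ) → sumMaps n m F ≡ v
sumMaps-concentrated zero    m F r₀ v F≡v F≡0 = F≡v _ (λ ())
sumMaps-concentrated (suc n) m F r₀ v F≡v F≡0 =
  trans (sumFin-concentrated m _ (r₀ fz) (λ a a≢r₀0 →
           sumMaps-zero n m _ (λ g → F≡0 _ (λ r≗r₀ → a≢r₀0 (r≗r₀ fz)))))
        (sumMaps-concentrated n m _ (λ i → r₀ (fs i)) v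
           (λ g g≗ → F≡v _ (λ { fz → refl ; (fs i) → g≗ i }))
           (λ g g≉ → F≡0 _ (λ r≗r₀ → g≉ (λ i → r≗r₀ (fs i)))))

-- coeffN K m w unfolds to sumMaps n m (contribution K w).
contribution : ∀ {n m} → SetComp n → Word n m → (Fin n → Fin m) → ℤ
contribution K w r = if ⌊ OrderCond? K r ⌋ ∧ ⌊ wordOf K r ≟W w ⌋ then 1ℤ else 0ℤ

contribution≡1 : ∀ {n m} (K : SetComp n) (w : Word n m) r →
  OrderCond K r → wordOf K r ≗ w → contribution K w r ≡ 1ℤ
contribution≡1 K w r oc r↦w with OrderCond? K r | wordOf K r ≟W w
... | yes _ | yes _   = refl
... | yes _ | no r↦̸w = contradiction r↦w r↦̸w
... | no ¬oc | _      = contradiction oc ¬oc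

contribution≡0 : ∀ {n m} (K : SetComp n) (w : Word n m) r →
  ¬ (OrderCond K r × wordOf K r ≗ w) → contribution K w r ≡ 0ℤ
contribution≡0 K w r ¬both with OrderCond? K r | wordOf K r ≟W w
... | yes oc | yes r↦w = contradiction (oc , r↦w) ¬both
... | yes _  | no _    = refl
... | no _   | _       = refl

canonical : ∀ {n} (K : SetComp n) → Fin n → Fin (parts K)
canonical K i = fromℕ< (blk<parts K i)

canonicalWord : ∀ {n} (K : SetComp n) → Word n (parts K)
canonicalWord K = wordOf K (canonical K)

coeffN-canonicalWord-self : ∀ {n} (K : SetComp n) → coeffN K (parts K) (canonicalWord K) ≡ 1ℤ
coeffN-canonicalWord-self {n} K =
  sumMaps-concentrated n (parts K) (contribution K (canonicalWord K)) (canonical K) 1ℤ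
    (λ r r≗c → contribution≡1 K _ r
       (orderCond-of-blk K (λ i → trans (cong toℕ (r≗c i)) (toℕ-fromℕ< (blk<parts K i))))
       (λ i → cong (inV₁ K i ,_) (r≗c i)))
    (λ r r≉c → contribution≡0 K _ r (λ (_ , r↦w) → r≉c (λ i → cong proj₂ (r↦w i))))

coeffN-canonicalWord-other : ∀ {n} (K K' : SetComp n) → ¬ blk K' ≗ blk K →
  coeffN K' (parts K) (canonicalWord K) ≡ 0ℤ
coeffN-canonicalWord-other {n} K K' K'≠K =
  sumMaps-zero n (parts K) _ (λ r → contribution≡0 K' _ r (λ (oc , r↦w) →
    K'≠K (blk-unique K K' (λ i → cong proj₁ (r↦w i)) oc
      (λ i → trans (cong (toℕ ∘ proj₂) (r↦w i)) (toℕ-fromℕ< (blk<parts K i))))))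

lemma6p14 : (n : ℕ) → n ≥ 1 →
    (k : ℕ) (K : Fin k → SetComp n) (c : Fin k → ℤ) →
    (∀ a → EvenParts (K a)) →
    (∀ a b → (∀ i → blk (K a) i ≡ blk (K b) i) → a ≡ b) →
    (∀ m (w : Word n m) → combCoeff k K c m w ≡ 0ℤ) →
    ∀ a → c a ≡ 0ℤ
lemma6p14 n _ k K c _ K-injective combination≡0 a = begin
  c a                                  ≡⟨ sym (*-identityʳ (c a)) ⟩
  c a * 1ℤ                             ≡⟨ cong (c a *_) (sym (coeffN-canonicalWord-self (K a))) ⟩
  c a * coeffN (K a) m w               ≡⟨ sym (sumFin-concentrated k _ a other-terms≡0) ⟩
  combCoeff k K c m w                  ≡⟨ combination≡0 m w ⟩
  0ℤ                                   ∎
  where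
  m : ℕ
  m = parts (K a)
  w : Word n m
  w = canonicalWord (K a)
  other-terms≡0 : ∀ b → b ≢ a → c b * coeffN (K b) m w ≡ 0ℤ
  other-terms≡0 b b≢a = trans
    (cong (c b *_) (coeffN-canonicalWord-other (K a) (K b) (λ same → b≢a (K-injective b a same))))
    (*-zeroʳ (c b))
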